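{- Let $m$ and $n$ be positive integers with $n \geq 4$ even, let $0 \leq \ell \leq n-1$ be an integer of the same parity as $m$, and let $$G = \langle t,x,y \mid t^2,\ x^{n/2},\ y^m = x^{(\ell + m)/2},\ txt = x^{ -1},\ tyt = y^{ -1},\ xy = yx\rangle.$$ Then there exists a group automorphism $\varphi$ of $G$ with $\varphi(t)=t$, $\varphi(tx)=ty$ and $\varphi(ty)=tx$ if and only if $\gcd(n,\ell+m) = 2m$ and $2mn \mid (\ell^2+2m\ell-3m^2)$. -}

module Defs where

open import Data.Nat using (ℕ; _*_; _+_; _/_)
open import Data.Bool using (Bool; true; false; not)
open import Data.Product using (_×_; _,_; Σ)
open import Data.List using (List; []; _∷_; _++_; replicate; reverse; map)
open import Data.List.Membership.Propositional using (_∈_)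

data Gen : Set where
  t x y : Gen

-- A letter is a generator together with an exponent sign (false = +1, true = -1).
Letter : Set
Letter = Gen × Bool

Word : Set
Word = List Letter

inv-letter : Letter → Letter
inv-letter (g , b) = g , not b

inv : Word → Word
inv w = reverse (map inv-letter w)

gen : Gen → Word
gen g = (g , false) ∷ []

pow : Gen → ℕ → Word
pow g k = replicate k (g , false)

-- Relators of  G = < t,x,y | t^2, x^(n/2), y^m = x^((ℓ+m)/2), txt = x^-1, tyt = y^-1, xy = yx >
-- each relation  u = v  is encoded by the relator  u v^-1.
relators : (n m ℓ : ℕ) → List Word
relators n m ℓ =
    pow t 2
  ∷ pow x (n / 2)
  ∷ (pow y m ++ inv (pow x ((ℓ + m) / 2)))
  ∷ (gen t ++ gen x ++ gen t ++ gen x)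
  ∷ (gen t ++ gen y ++ gen t ++ gen y)
  ∷ (gen x ++ gen y ++ inv (gen x) ++ inv (gen y))
  ∷ []

-- Equality in G: the congruence on words generated by free cancellation
-- and by deleting/inserting relators.
data _≈[_,_,_]_ : Word → ℕ → ℕ → ℕ → Word → Set where
  ≈-refl  : ∀ {n m ℓ w} → w ≈[ n , m , ℓ ] w
  ≈-sym   : ∀ {n m ℓ u v} → u ≈[ n , m , ℓ ] v → v ≈[ n , m , ℓ ] u
  ≈-trans : ∀ {n m ℓ u v w} → u ≈[ n , m , ℓ ] v → v ≈[ n , m , ℓ ] w → u ≈[ n , m , ℓ ] w
  ≈-cancel : ∀ {n m ℓ} (u v : Word) (a : Letter) →
             (u ++ a ∷ inv-letter a ∷ v) ≈[ n , m , ℓ ] (u ++ v)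
  ≈-rel   : ∀ {n m ℓ} (u v r : Word) → r ∈ relators n m ℓ →
             (u ++ r ++ v) ≈[ n , m , ℓ ] (u ++ v)

-- A group automorphism of G (G as the setoid of words modulo ≈):
-- a well-defined map on words that is a homomorphism and a bijection of G.
record IsAutomorphism (n m ℓ : ℕ) (φ : Word → Word) : Set where
  field
    well-defined : ∀ u v → u ≈[ n , m , ℓ ] v → φ u ≈[ n , m , ℓ ] φ v
    homomorphism : ∀ u v → φ (u ++ v) ≈[ n , m , ℓ ] (φ u ++ φ v)
    injective    : ∀ u v → φ u ≈[ n , m , ℓ ] φ v → u ≈[ n , m , ℓ ] v
    surjective   : ∀ w → Σ Word (λ u → φ u ≈[ n , m , ℓ ] w)

module Submission where

-- Every element of G has a unique normal form x^a y^b t^s, with (a , b) read modulo the lattice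
-- Λ ⊆ ℤ² spanned by (n/2 , 0) and (-(ℓ+m)/2 , m): G is (ℤ²/Λ) ⋊ C₂, with t acting by negation.
-- An automorphism fixing t and exchanging tx and ty must exchange x and y, so it is the letter
-- swap, and the swap is well defined exactly when Λ is symmetric under (a , b) ↦ (b , a).
-- With N = n/2 and k = (ℓ+m)/2 this says m ∣ N, m ∣ k and (k/m)² ≡ 1 mod N/m, which is the stated
-- condition because gcd(n , ℓ+m) = 2 gcd(N , k) and ℓ² + 2mℓ - 3m² = 4 (k² - m²).

open import Defs
open import Data.Bool.Base using (Bool; true; false; not; _xor_)
open import Data.Integer.Base using (ℤ)
open import Data.List.Base using ([]; _∷_; _∷ʳ_; _++_; replicate; reverse; map)
open import Data.List.Properties using (unfold-reverse)
open import Data.Nat.Base using (ℕ; zero; suc)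
open import Data.Product.Base using (Σ; _×_; _,_; ∃₂; proj₁; proj₂)
open import Function.Bundles using (_⇔_; mk⇔)
open import Relation.Binary.PropositionalEquality

reverse-replicate : ∀ {A : Set} k (a : A) → reverse (replicate k a) ≡ replicate k a
reverse-replicate zero    a = refl
reverse-replicate (suc k) a = begin
  reverse (a ∷ replicate k a)   ≡⟨ unfold-reverse a (replicate k a) ⟩
  reverse (replicate k a) ∷ʳ a  ≡⟨ cong (_∷ʳ a) (reverse-replicate k a) ⟩
  replicate k a ∷ʳ a            ≡⟨ replicate-∷ʳ k ⟩
  a ∷ replicate k a             ∎
  where
  open ≡-Reasoning
  replicate-∷ʳ : ∀ k → replicate k a ∷ʳ a ≡ a ∷ replicate k a
  replicate-∷ʳ zero    = refl
  replicate-∷ʳ (suc k) = cong (a ∷_) (replicate-∷ʳ k)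

module ℤ²⋊C₂ where

  open import Data.Bool.Properties using (xor-same; xor-assoc)
  open import Data.Integer.Base using (+_; -[1+_]; 0ℤ; 1ℤ; -1ℤ; -_; _+_; _-_)
  open import Data.List.Properties using (map-replicate)
  open import Data.Integer.Properties
    using (+-identityˡ; +-identityʳ; +-assoc; +-inverseˡ; neg-distrib-+; neg-involutive)
  open ≡-Reasoning

  -- (a , b , s) stands for x^a y^b t^s.
  Elem : Set
  Elem = ℤ × ℤ × Bool

  σ : Bool → ℤ → ℤ
  σ false a = a
  σ true  a = - a

  σ-+ : ∀ s a b → σ s (a + b) ≡ σ s a + σ s b
  σ-+ false a b = refl
  σ-+ true  a b = neg-distrib-+ a b

  σ-σ : ∀ s s′ a → σ s (σ s′ a) ≡ σ (s xor s′) a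
  σ-σ false s′    a = refl
  σ-σ true  false a = refl
  σ-σ true  true  a = neg-involutive a

  σ-minus : ∀ s a b → σ s (a - b) ≡ σ s a - σ s b
  σ-minus false a b = refl
  σ-minus true  a b = neg-distrib-+ a (- b)

  infixl 7 _·_
  _·_ : Elem → Elem → Elem
  (a , b , s) · (c , d , s′) = a + σ s c , b + σ s d , s xor s′

  ε : Elem
  ε = 0ℤ , 0ℤ , false

  infix 8 _⁻¹
  _⁻¹ : Elem → Elem
  (a , b , s) ⁻¹ = - σ s a , - σ s b , s

  ·-assoc : ∀ e f g → (e · f) · g ≡ e · (f · g)
  ·-assoc (a , b , s) (c , d , s′) (e , f , s″) =
    cong₂ _,_ (coordinate a c e) (cong₂ _,_ (coordinate b d f) (xor-assoc s s′ s″))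
    where
    coordinate : ∀ a c e → a + σ s c + σ (s xor s′) e ≡ a + σ s (c + σ s′ e)
    coordinate a c e = begin
      a + σ s c + σ (s xor s′) e     ≡⟨ +-assoc a (σ s c) _ ⟩
      a + (σ s c + σ (s xor s′) e)   ≡⟨ cong (λ z → a + (σ s c + z)) (σ-σ s s′ e) ⟨
      a + (σ s c + σ s (σ s′ e))     ≡⟨ cong (λ z → a + z) (σ-+ s c (σ s′ e)) ⟨
      a + σ s (c + σ s′ e)           ∎

  ·-identityˡ : ∀ e → ε · e ≡ e
  ·-identityˡ (a , b , s) = cong₂ _,_ (+-identityˡ a) (cong (_, s) (+-identityˡ b))

  ·-inverseˡ : ∀ e → e ⁻¹ · e ≡ ε
  ·-inverseˡ (a , b , s) =
    cong₂ _,_ (+-inverseˡ (σ s a)) (cong₂ _,_ (+-inverseˡ (σ s b)) (xor-same s))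

  ⟦_⟧ : Letter → Elem
  ⟦ x , false ⟧ = 1ℤ  , 0ℤ  , false
  ⟦ x , true  ⟧ = -1ℤ , 0ℤ  , false
  ⟦ y , false ⟧ = 0ℤ  , 1ℤ  , false
  ⟦ y , true  ⟧ = 0ℤ  , -1ℤ , false
  ⟦ t , _     ⟧ = 0ℤ  , 0ℤ  , true

  ⟦⟧-cancel : ∀ a e → ⟦ a ⟧ · (⟦ inv-letter a ⟧ · e) ≡ e
  ⟦⟧-cancel a e = begin
    ⟦ a ⟧ · (⟦ inv-letter a ⟧ · e)  ≡⟨ ·-assoc ⟦ a ⟧ ⟦ inv-letter a ⟧ e ⟨
    ⟦ a ⟧ · ⟦ inv-letter a ⟧ · e    ≡⟨ cong (_· e) (⟦⟧-inverse a) ⟩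
    ε · e                           ≡⟨ ·-identityˡ e ⟩
    e                               ∎
    where
    ⟦⟧-inverse : ∀ a → ⟦ a ⟧ · ⟦ inv-letter a ⟧ ≡ ε
    ⟦⟧-inverse (x , false) = refl
    ⟦⟧-inverse (x , true)  = refl
    ⟦⟧-inverse (y , false) = refl
    ⟦⟧-inverse (y , true)  = refl
    ⟦⟧-inverse (t , false) = refl
    ⟦⟧-inverse (t , true)  = refl

  eval : Word → Elem
  eval []      = ε
  eval (a ∷ w) = ⟦ a ⟧ · eval w

  eval-++ : ∀ u v → eval (u ++ v) ≡ eval u · eval v
  eval-++ []      v = sym (·-identityˡ (eval v))
  eval-++ (a ∷ u) v = trans (cong (⟦ a ⟧ ·_) (eval-++ u v)) (sym (·-assoc ⟦ a ⟧ (eval u) (eval v)))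

  eval-cancel : ∀ u v a → eval (u ++ a ∷ inv-letter a ∷ v) ≡ eval (u ++ v)
  eval-cancel u v a = begin
    eval (u ++ a ∷ inv-letter a ∷ v)               ≡⟨ eval-++ u _ ⟩
    eval u · (⟦ a ⟧ · (⟦ inv-letter a ⟧ · eval v))  ≡⟨ cong (eval u ·_) (⟦⟧-cancel a (eval v)) ⟩
    eval u · eval v                                ≡⟨ eval-++ u v ⟨
    eval (u ++ v)                                  ∎

  _⁺ _⁻ : Gen → Letter
  g ⁺ = g , false
  g ⁻ = g , true

  zpow : Gen → ℤ → Word
  zpow g (+ k)    = replicate k (g ⁺)
  zpow g -[1+ k ] = replicate (suc k) (g ⁻)

  tpow : Bool → Word
  tpow false = []
  tpow true  = t ⁺ ∷ []

  nf : Elem → Word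
  nf (a , b , s) = zpow x a ++ zpow y b ++ tpow s

  eval-zpow-x : ∀ a → eval (zpow x a) ≡ (a , 0ℤ , false)
  eval-zpow-x (+ zero)      = refl
  eval-zpow-x (+ suc k)     = cong (⟦ x ⁺ ⟧ ·_) (eval-zpow-x (+ k))
  eval-zpow-x -[1+ zero ]   = refl
  eval-zpow-x -[1+ suc k ]  = cong (⟦ x ⁻ ⟧ ·_) (eval-zpow-x -[1+ k ])

  eval-zpow-y : ∀ b → eval (zpow y b) ≡ (0ℤ , b , false)
  eval-zpow-y (+ zero)      = refl
  eval-zpow-y (+ suc k)     = cong (⟦ y ⁺ ⟧ ·_) (eval-zpow-y (+ k))
  eval-zpow-y -[1+ zero ]   = refl
  eval-zpow-y -[1+ suc k ]  = cong (⟦ y ⁻ ⟧ ·_) (eval-zpow-y -[1+ k ])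

  eval-tpow : ∀ s → eval (tpow s) ≡ (0ℤ , 0ℤ , s)
  eval-tpow false = refl
  eval-tpow true  = refl

  eval-nf : ∀ e → eval (nf e) ≡ e
  eval-nf (a , b , s) = begin
    eval (zpow x a ++ zpow y b ++ tpow s)
      ≡⟨ trans (eval-++ (zpow x a) _) (cong (eval (zpow x a) ·_) (eval-++ (zpow y b) (tpow s))) ⟩
    eval (zpow x a) · (eval (zpow y b) · eval (tpow s))
      ≡⟨ cong₂ _·_ (eval-zpow-x a) (cong₂ _·_ (eval-zpow-y b) (eval-tpow s)) ⟩
    (a + 0ℤ , 0ℤ + (b + 0ℤ) , s)
      ≡⟨ cong₂ _,_ (+-identityʳ a) (cong (_, s) (trans (+-identityˡ _) (+-identityʳ b))) ⟩
    (a , b , s) ∎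

  swap : Letter → Letter
  swap (x , b) = y , b
  swap (y , b) = x , b
  swap (t , b) = t , b

  map-swap-involutive : ∀ w → map swap (map swap w) ≡ w
  map-swap-involutive []            = refl
  map-swap-involutive ((x , b) ∷ w) = cong ((x , b) ∷_) (map-swap-involutive w)
  map-swap-involutive ((y , b) ∷ w) = cong ((y , b) ∷_) (map-swap-involutive w)
  map-swap-involutive ((t , b) ∷ w) = cong ((t , b) ∷_) (map-swap-involutive w)

  swapᴱ : Elem → Elem
  swapᴱ (a , b , s) = b , a , s

  eval-swap : ∀ w → eval (map swap w) ≡ swapᴱ (eval w)
  eval-swap []      = refl
  eval-swap (l ∷ w) = trans (cong (⟦ swap l ⟧ ·_) (eval-swap w)) (⟦swap⟧-· l (eval w))
    where
    ⟦swap⟧-· : ∀ l e → ⟦ swap l ⟧ · swapᴱ e ≡ swapᴱ (⟦ l ⟧ · e)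
    ⟦swap⟧-· (x , false) e = refl
    ⟦swap⟧-· (x , true)  e = refl
    ⟦swap⟧-· (y , false) e = refl
    ⟦swap⟧-· (y , true)  e = refl
    ⟦swap⟧-· (t , b)     e = refl

  inv-pow : ∀ g k → inv (pow g k) ≡ zpow g (- + k)
  inv-pow g k = begin
    reverse (map inv-letter (replicate k (g ⁺)))  ≡⟨ cong reverse (map-replicate inv-letter k (g ⁺)) ⟩
    reverse (replicate k (g ⁻))                   ≡⟨ reverse-replicate k (g ⁻) ⟩
    replicate k (g ⁻)                             ≡⟨ zpow-neg k ⟨
    zpow g (- + k)                                ∎
    where
    zpow-neg : ∀ k → zpow g (- + k) ≡ replicate k (g ⁻)
    zpow-neg zero    = refl
    zpow-neg (suc k) = refl

  eval-y^m-x^-k : ∀ m k → eval (pow y m ++ inv (pow x k)) ≡ (- + k , + m , false)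
  eval-y^m-x^-k m k = begin
    eval (pow y m ++ inv (pow x k))
      ≡⟨ eval-++ (pow y m) (inv (pow x k)) ⟩
    eval (pow y m) · eval (inv (pow x k))
      ≡⟨ cong₂ _·_ (eval-zpow-y (+ m)) (trans (cong eval (inv-pow x k)) (eval-zpow-x (- + k))) ⟩
    (0ℤ + - + k , + m + 0ℤ , false)
      ≡⟨ cong₂ _,_ (+-identityˡ (- + k)) (cong (_, false) (+-identityʳ (+ m))) ⟩
    (- + k , + m , false) ∎

module Lattice (N K M : ℤ) where

  open import Data.Integer.Base using (+_; -[1+_]; 0ℤ; 1ℤ; -1ℤ; pred; -_; _+_; _-_; _*_; ≢-nonZero)
    renaming (suc to sucℤ)
  open import Data.Integer.Properties
    using (+-identityˡ; +-identityʳ; +-inverseʳ; +-minus-telescope; *-identityʳ; *-zeroʳ; *-comm;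
           suc-*; *-distribʳ-+; -1*i≡-i; *-cancelˡ-≡)
  open import Data.Integer.Tactic.RingSolver using (solve)
  open ≡-Reasoning
  open ℤ²⋊C₂

  ℤ-induction : (P : ℤ → Set) → P 0ℤ →
                (∀ i → P i → P (sucℤ i)) → (∀ i → P i → P (pred i)) → ∀ i → P i
  ℤ-induction P P0 Psuc Ppred (+ zero)        = P0
  ℤ-induction P P0 Psuc Ppred (+ suc n)       = Psuc (+ n) (ℤ-induction P P0 Psuc Ppred (+ n))
  ℤ-induction P P0 Psuc Ppred -[1+ zero ]     = Ppred 0ℤ P0
  ℤ-induction P P0 Psuc Ppred -[1+ suc n ]    = Ppred -[1+ n ] (ℤ-induction P P0 Psuc Ppred -[1+ n ])

  record SwapCriterion : Set where
    constructor swapCriterion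
    field
      N′ k′ c    : ℤ
      N≡M*N′     : N ≡ M * N′
      K≡M*k′     : K ≡ M * k′
      k′²-1≡c*N′ : k′ * k′ - 1ℤ ≡ c * N′

  infix 4 _∈Λ
  _∈Λ : ℤ × ℤ → Set
  (p , q) ∈Λ = ∃₂ λ i j → p ≡ i * N + j * K × q ≡ j * M

  SwapClosed : Set
  SwapClosed = ∀ {p q} → (p , q) ∈Λ → (q , p) ∈Λ

  N∈Λ : (N , 0ℤ) ∈Λ
  N∈Λ = 1ℤ , 0ℤ , solve (N ∷ K ∷ []) , refl

  KM∈Λ : (K , M) ∈Λ
  KM∈Λ = 0ℤ , 1ℤ , solve (N ∷ K ∷ []) , solve (M ∷ [])

  Λ-induction : (P : ℤ × ℤ → Set) → P (0ℤ , 0ℤ) → P (N , 0ℤ) → P (K , M) →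
                (∀ {p q p′ q′} → P (p , q) → P (p′ , q′) → P (p + p′ , q + q′)) →
                (∀ {p q} → P (p , q) → P (- p , - q)) →
                ∀ {v} → v ∈Λ → P v
  Λ-induction P P0 PN PKM P+ P- (i , j , refl , refl) =
    subst P (cong (i * N + j * K ,_) (trans (cong (_+ j * M) (*-zeroʳ i)) (+-identityˡ (j * M))))
      (P+ (multiples PN i) (multiples PKM j))
    where
    multiples : ∀ {a b} → P (a , b) → ∀ i → P (i * a , i * b)
    multiples {a} {b} Pab = ℤ-induction (λ i → P (i * a , i * b)) P0
      (λ i Pi → subst P (sym (cong₂ _,_ (suc-* i a) (suc-* i b))) (P+ Pab Pi))
      (λ i Pi → subst P (sym (cong₂ _,_ (pred-* i a) (pred-* i b))) (P+ (P- Pab) Pi))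
      where
      pred-* : ∀ i a → pred i * a ≡ - a + i * a
      pred-* i a = trans (*-distribʳ-+ a -1ℤ i) (cong (_+ i * a) (-1*i≡-i a))

  ∈Λ-0 : (0ℤ , 0ℤ) ∈Λ
  ∈Λ-0 = 0ℤ , 0ℤ , refl , refl

  ∈Λ-neg : ∀ {p q} → (p , q) ∈Λ → (- p , - q) ∈Λ
  ∈Λ-neg (i , j , refl , refl) = - i , - j , solve (i ∷ j ∷ N ∷ K ∷ []) , solve (j ∷ M ∷ [])

  ∈Λ-+ : ∀ {p q p′ q′} → (p , q) ∈Λ → (p′ , q′) ∈Λ → (p + p′ , q + q′) ∈Λ
  ∈Λ-+ (i , j , refl , refl) (i′ , j′ , refl , refl) =
    i + i′ , j + j′ , solve (i ∷ j ∷ i′ ∷ j′ ∷ N ∷ K ∷ []) , solve (j ∷ j′ ∷ M ∷ [])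

  ∈Λ-σ : ∀ s {p q} → (p , q) ∈Λ → (σ s p , σ s q) ∈Λ
  ∈Λ-σ false v∈Λ = v∈Λ
  ∈Λ-σ true  v∈Λ = ∈Λ-neg v∈Λ

  ∈Λ-resp : ∀ {p q p′ q′} → p ≡ p′ → q ≡ q′ → (p , q) ∈Λ → (p′ , q′) ∈Λ
  ∈Λ-resp refl refl v∈Λ = v∈Λ

  infix 4 _~_
  data _~_ : Elem → Elem → Set where
    ~-intro : ∀ {a b a′ b′ s} → (a - a′ , b - b′) ∈Λ → (a , b , s) ~ (a′ , b′ , s)

  ∈Λ⇒~ε : ∀ {p q} → (p , q) ∈Λ → (p , q , false) ~ ε
  ∈Λ⇒~ε {p} {q} v∈Λ = ~-intro (∈Λ-resp (sym (+-identityʳ p)) (sym (+-identityʳ q)) v∈Λ)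

  ~ε⇒∈Λ : ∀ {p q} → (p , q , false) ~ ε → (p , q) ∈Λ
  ~ε⇒∈Λ {p} {q} (~-intro v∈Λ) = ∈Λ-resp (+-identityʳ p) (+-identityʳ q) v∈Λ

  ~-reflexive : ∀ {e f} → e ≡ f → e ~ f
  ~-reflexive {a , b , s} refl = ~-intro (∈Λ-resp (sym (+-inverseʳ a)) (sym (+-inverseʳ b)) ∈Λ-0)

  ~-sym : ∀ {e f} → e ~ f → f ~ e
  ~-sym (~-intro {a} {b} {a′} {b′} v∈Λ) =
    ~-intro (∈Λ-resp (negate a a′) (negate b b′) (∈Λ-neg v∈Λ))
    where
    negate : ∀ a a′ → - (a - a′) ≡ a′ - a
    negate a a′ = solve (a ∷ a′ ∷ [])

  ~-trans : ∀ {e f g} → e ~ f → f ~ g → e ~ g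
  ~-trans (~-intro {a} {b} {a′} {b′} v∈Λ) (~-intro {a′ = a″} {b′ = b″} w∈Λ) =
    ~-intro (∈Λ-resp (+-minus-telescope a a′ a″) (+-minus-telescope b b′ b″) (∈Λ-+ v∈Λ w∈Λ))

  ·-congˡ : ∀ e {f f′} → f ~ f′ → e · f ~ e · f′
  ·-congˡ (a , b , s) (~-intro {c} {d} {c′} {d′} v∈Λ) =
    ~-intro (∈Λ-resp (translate s a c c′) (translate s b d d′) (∈Λ-σ s v∈Λ))
    where
    shift : ∀ a u u′ → u - u′ ≡ (a + u) - (a + u′)
    shift a u u′ = solve (a ∷ u ∷ u′ ∷ [])
    translate : ∀ s a c c′ → σ s (c - c′) ≡ (a + σ s c) - (a + σ s c′)
    translate s a c c′ = trans (σ-minus s c c′) (shift a (σ s c) (σ s c′))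

  ·-congʳ : ∀ {e e′} f → e ~ e′ → e · f ~ e′ · f
  ·-congʳ (c , d , _) (~-intro {a} {b} {a′} {b′} {s} v∈Λ) =
    ~-intro (∈Λ-resp (shift a a′ (σ s c)) (shift b b′ (σ s d)) v∈Λ)
    where
    shift : ∀ a a′ z → a - a′ ≡ (a + z) - (a′ + z)
    shift a a′ z = solve (a ∷ a′ ∷ z ∷ [])

  ·-cancelˡ : ∀ e {f f′} → e · f ~ e · f′ → f ~ f′
  ·-cancelˡ e {f} {f′} ef~ef′ = subst₂ _~_ (cancel f) (cancel f′) (·-congˡ (e ⁻¹) ef~ef′)
    where
    cancel : ∀ f → e ⁻¹ · (e · f) ≡ f
    cancel f = begin
      e ⁻¹ · (e · f)  ≡⟨ ·-assoc (e ⁻¹) e f ⟨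
      e ⁻¹ · e · f    ≡⟨ cong (_· f) (·-inverseˡ e) ⟩
      ε · f           ≡⟨ ·-identityˡ f ⟩
      f               ∎

  swapᴱ-~ : SwapClosed → ∀ {e f} → e ~ f → swapᴱ e ~ swapᴱ f
  swapᴱ-~ closed (~-intro d∈Λ) = ~-intro (closed d∈Λ)

  criterion⇒swapClosed : SwapCriterion → SwapClosed
  criterion⇒swapClosed (swapCriterion N′ k′ c N≡M*N′ K≡M*k′ k′²-1≡c*N′)
                       (i , j , refl , refl) =
    - (i * k′ + j * c) , i * N′ + j * k′ , p≡ , q≡
    where
    p≡ : j * M ≡ - (i * k′ + j * c) * N + (i * N′ + j * k′) * K
    p≡ = sym (begin
      - (i * k′ + j * c) * N + (i * N′ + j * k′) * K
        ≡⟨ cong₂ (λ a b → - (i * k′ + j * c) * a + (i * N′ + j * k′) * b) N≡M*N′ K≡M*k′ ⟩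
      - (i * k′ + j * c) * (M * N′) + (i * N′ + j * k′) * (M * k′)
        ≡⟨ solve (i ∷ j ∷ k′ ∷ c ∷ M ∷ N′ ∷ []) ⟩
      j * M * (k′ * k′ - c * N′)
        ≡⟨ cong (λ z → j * M * (k′ * k′ - z)) k′²-1≡c*N′ ⟨
      j * M * (k′ * k′ - (k′ * k′ - 1ℤ))
        ≡⟨ solve (j ∷ M ∷ k′ ∷ []) ⟩
      j * M ∎)
    q≡ : i * N + j * K ≡ (i * N′ + j * k′) * M
    q≡ = begin
      i * N + j * K                  ≡⟨ cong₂ (λ a b → i * a + j * b) N≡M*N′ K≡M*k′ ⟩
      i * (M * N′) + j * (M * k′)    ≡⟨ solve (i ∷ j ∷ M ∷ N′ ∷ k′ ∷ []) ⟩
      (i * N′ + j * k′) * M          ∎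

  swapClosed⇒criterion : M ≢ 0ℤ → SwapClosed → SwapCriterion
  swapClosed⇒criterion M≢0 closed with closed N∈Λ | closed KM∈Λ
  ... | _ , j , _ , N≡jM | i′ , j′ , M≡ , K≡j′M =
    swapCriterion j j′ (- i′) (trans N≡jM (*-comm j M)) (trans K≡j′M (*-comm j′ M)) k′²-1≡
    where
    unit : 1ℤ ≡ i′ * j + j′ * j′
    unit = *-cancelˡ-≡ M 1ℤ _ {{≢-nonZero M≢0}} (begin
      M * 1ℤ                        ≡⟨ *-identityʳ M ⟩
      M                             ≡⟨ M≡ ⟩
      i′ * N + j′ * K               ≡⟨ cong₂ (λ a b → i′ * a + j′ * b) N≡jM K≡j′M ⟩
      i′ * (j * M) + j′ * (j′ * M)  ≡⟨ solve (i′ ∷ j ∷ j′ ∷ M ∷ []) ⟩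
      M * (i′ * j + j′ * j′)        ∎)
    k′²-1≡ : j′ * j′ - 1ℤ ≡ - i′ * j
    k′²-1≡ = begin
      j′ * j′ - 1ℤ                     ≡⟨ cong (λ z → j′ * j′ - z) unit ⟩
      j′ * j′ - (i′ * j + j′ * j′)     ≡⟨ solve (i′ ∷ j ∷ j′ ∷ []) ⟩
      - i′ * j                         ∎

  swapClosed⇔criterion : M ≢ 0ℤ → SwapClosed ⇔ SwapCriterion
  swapClosed⇔criterion M≢0 = mk⇔ (swapClosed⇒criterion M≢0) criterion⇒swapClosed

module Presentation (n m ℓ : ℕ) where

  import Data.Nat.Base as ℕ
  open import Data.Integer.Base using (+_; -[1+_]; -_; _+_; _-_; pred) renaming (suc to sucℤ)
  open import Data.Integer.Tactic.RingSolver using (solve)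
  open import Function.Base using (_∘_)
  open import Data.Integer.Properties using (+-identityˡ; +-inverseˡ)
  open import Data.List.Properties using (++-assoc; ++-identityʳ; map-++)
  open import Data.List.Membership.Propositional using (_∈_)
  open import Data.List.Relation.Unary.Any using (here; there)
  open import Level using (0ℓ)
  open import Relation.Binary.Bundles using (Setoid)
  import Relation.Binary.Reasoning.Setoid as SetoidReasoning
  open ℤ²⋊C₂
  open Lattice (+ (n ℕ./ 2)) (- + ((ℓ ℕ.+ m) ℕ./ 2)) (+ m) public

  infix 4 _≈_
  _≈_ : Word → Word → Set
  u ≈ v = u ≈[ n , m , ℓ ] v

  ≈-setoid : Setoid 0ℓ 0ℓ
  ≈-setoid = record
    { Carrier = Word ; _≈_ = _≈_
    ; isEquivalence = record { refl = ≈-refl ; sym = ≈-sym ; trans = ≈-trans } }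

  open SetoidReasoning ≈-setoid

  ≡⇒≈ : ∀ {u v} → u ≡ v → u ≈ v
  ≡⇒≈ refl = ≈-refl

  ++-congˡ : ∀ w {u v} → u ≈ v → w ++ u ≈ w ++ v
  ++-congˡ w ≈-refl                = ≈-refl
  ++-congˡ w (≈-sym u≈v)           = ≈-sym (++-congˡ w u≈v)
  ++-congˡ w (≈-trans u≈v v≈w)     = ≈-trans (++-congˡ w u≈v) (++-congˡ w v≈w)
  ++-congˡ w (≈-cancel u v a)      =
    subst₂ _≈_ (++-assoc w u _) (++-assoc w u v) (≈-cancel (w ++ u) v a)
  ++-congˡ w (≈-rel u v r r∈)      =
    subst₂ _≈_ (++-assoc w u _) (++-assoc w u v) (≈-rel (w ++ u) v r r∈)

  ++-congʳ : ∀ w {u v} → u ≈ v → u ++ w ≈ v ++ w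
  ++-congʳ w ≈-refl                = ≈-refl
  ++-congʳ w (≈-sym u≈v)           = ≈-sym (++-congʳ w u≈v)
  ++-congʳ w (≈-trans u≈v v≈w)     = ≈-trans (++-congʳ w u≈v) (++-congʳ w v≈w)
  ++-congʳ w (≈-cancel u v a)      =
    subst₂ _≈_ (sym (++-assoc u _ w)) (sym (++-assoc u v w)) (≈-cancel u (v ++ w) a)
  ++-congʳ w (≈-rel u v r r∈)      =
    subst₂ _≈_ (trans (cong (u ++_) (sym (++-assoc r v w))) (sym (++-assoc u (r ++ v) w)))
               (sym (++-assoc u v w)) (≈-rel u (v ++ w) r r∈)

  ++-cong : ∀ {u u′ v v′} → u ≈ u′ → v ≈ v′ → u ++ v ≈ u′ ++ v′
  ++-cong {u′ = u′} {v} u≈u′ v≈v′ = ≈-trans (++-congʳ v u≈u′) (++-congˡ u′ v≈v′)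

  relator≈[] : ∀ {r} → r ∈ relators n m ℓ → r ≈ []
  relator≈[] {r} r∈ = subst₂ _≈_ (++-identityʳ r) refl (≈-rel [] [] r r∈)

  inverse≈[] : ∀ a → a ∷ inv-letter a ∷ [] ≈ []
  inverse≈[] a = ≈-cancel [] [] a

  t²≈[] : t ⁺ ∷ t ⁺ ∷ [] ≈ []
  t²≈[] = relator≈[] (here refl)

  t⁻≈t⁺ : t ⁻ ∷ [] ≈ t ⁺ ∷ []
  t⁻≈t⁺ = begin
    t ⁻ ∷ []              ≈⟨ ++-congˡ (t ⁻ ∷ []) t²≈[] ⟨
    t ⁻ ∷ t ⁺ ∷ t ⁺ ∷ []  ≈⟨ ++-congʳ (t ⁺ ∷ []) (inverse≈[] (t ⁻)) ⟩
    t ⁺ ∷ []              ∎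

  t-inverts : ∀ g → t ⁺ ∷ g ⁺ ∷ t ⁺ ∷ g ⁺ ∷ [] ≈ [] →
              t ⁺ ∷ g ⁺ ∷ [] ≈ g ⁻ ∷ t ⁺ ∷ []
              × t ⁺ ∷ g ⁻ ∷ [] ≈ g ⁺ ∷ t ⁺ ∷ []
  t-inverts g tgtg≈[] = tg⁺≈g⁻t , tg⁻≈g⁺t
    where
    tg⁺≈g⁻t : t ⁺ ∷ g ⁺ ∷ [] ≈ g ⁻ ∷ t ⁺ ∷ []
    tg⁺≈g⁻t = ≈-sym (begin
      g ⁻ ∷ t ⁺ ∷ []
        ≈⟨ ++-congˡ (g ⁻ ∷ t ⁺ ∷ []) tgtg≈[] ⟨
      g ⁻ ∷ t ⁺ ∷ t ⁺ ∷ g ⁺ ∷ t ⁺ ∷ g ⁺ ∷ []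
        ≈⟨ ++-congˡ (g ⁻ ∷ []) (++-congʳ (g ⁺ ∷ t ⁺ ∷ g ⁺ ∷ []) t²≈[]) ⟩
      g ⁻ ∷ g ⁺ ∷ t ⁺ ∷ g ⁺ ∷ []
        ≈⟨ ++-congʳ (t ⁺ ∷ g ⁺ ∷ []) (inverse≈[] (g ⁻)) ⟩
      t ⁺ ∷ g ⁺ ∷ [] ∎)
    tg⁻≈g⁺t : t ⁺ ∷ g ⁻ ∷ [] ≈ g ⁺ ∷ t ⁺ ∷ []
    tg⁻≈g⁺t = begin
      t ⁺ ∷ g ⁻ ∷ []
        ≈⟨ ++-congʳ (t ⁺ ∷ g ⁻ ∷ []) (inverse≈[] (g ⁺)) ⟨
      g ⁺ ∷ g ⁻ ∷ t ⁺ ∷ g ⁻ ∷ []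
        ≈⟨ ++-congˡ (g ⁺ ∷ []) (++-congʳ (g ⁻ ∷ []) tg⁺≈g⁻t) ⟨
      g ⁺ ∷ t ⁺ ∷ g ⁺ ∷ g ⁻ ∷ []
        ≈⟨ ++-congˡ (g ⁺ ∷ t ⁺ ∷ []) (inverse≈[] (g ⁺)) ⟩
      g ⁺ ∷ t ⁺ ∷ [] ∎

  y⁺x⁺≈x⁺y⁺ : y ⁺ ∷ x ⁺ ∷ [] ≈ x ⁺ ∷ y ⁺ ∷ []
  y⁺x⁺≈x⁺y⁺ = begin
    y ⁺ ∷ x ⁺ ∷ []
      ≈⟨ ++-congʳ (y ⁺ ∷ x ⁺ ∷ []) xyx⁻y⁻≈[] ⟨
    x ⁺ ∷ y ⁺ ∷ x ⁻ ∷ y ⁻ ∷ y ⁺ ∷ x ⁺ ∷ []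
      ≈⟨ ++-congˡ (x ⁺ ∷ y ⁺ ∷ x ⁻ ∷ []) (++-congʳ (x ⁺ ∷ []) (inverse≈[] (y ⁻))) ⟩
    x ⁺ ∷ y ⁺ ∷ x ⁻ ∷ x ⁺ ∷ []
      ≈⟨ ++-congˡ (x ⁺ ∷ y ⁺ ∷ []) (inverse≈[] (x ⁻)) ⟩
    x ⁺ ∷ y ⁺ ∷ [] ∎
    where
    xyx⁻y⁻≈[] : x ⁺ ∷ y ⁺ ∷ x ⁻ ∷ y ⁻ ∷ [] ≈ []
    xyx⁻y⁻≈[] = relator≈[] (there (there (there (there (there (here refl))))))

  commute-⁻ : ∀ g a → g ⁺ ∷ a ∷ [] ≈ a ∷ g ⁺ ∷ [] → g ⁻ ∷ a ∷ [] ≈ a ∷ g ⁻ ∷ []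
  commute-⁻ g a ga≈ag = begin
    g ⁻ ∷ a ∷ []              ≈⟨ ++-congˡ (g ⁻ ∷ a ∷ []) (inverse≈[] (g ⁺)) ⟨
    g ⁻ ∷ a ∷ g ⁺ ∷ g ⁻ ∷ []  ≈⟨ ++-congˡ (g ⁻ ∷ []) (++-congʳ (g ⁻ ∷ []) ga≈ag) ⟨
    g ⁻ ∷ g ⁺ ∷ a ∷ g ⁻ ∷ []  ≈⟨ ++-congʳ (a ∷ g ⁻ ∷ []) (inverse≈[] (g ⁻)) ⟩
    a ∷ g ⁻ ∷ []              ∎

  y-commutes-x : ∀ b c → (y , b) ∷ (x , c) ∷ [] ≈ (x , c) ∷ (y , b) ∷ []
  y-commutes-x false false = y⁺x⁺≈x⁺y⁺
  y-commutes-x false true  = ≈-sym (commute-⁻ x (y ⁺) (≈-sym y⁺x⁺≈x⁺y⁺))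
  y-commutes-x true  false = commute-⁻ y (x ⁺) (y-commutes-x false false)
  y-commutes-x true  true  = commute-⁻ y (x ⁻) (y-commutes-x false true)

  pass : ∀ {a b c} → a ∷ b ∷ [] ≈ c ∷ a ∷ [] →
         ∀ k → a ∷ replicate k b ≈ replicate k c ++ a ∷ []
  pass ab≈ca zero    = ≈-refl
  pass ab≈ca (suc k) =
    ≈-trans (++-congʳ (replicate k _) ab≈ca) (++-congˡ (_ ∷ []) (pass ab≈ca k))

  zpow-suc : ∀ g a → g ⁺ ∷ zpow g a ≈ zpow g (sucℤ a)
  zpow-suc g (+ k)         = ≈-refl
  zpow-suc g -[1+ zero ]   = inverse≈[] (g ⁺)
  zpow-suc g -[1+ suc k ]  = ≈-cancel [] (zpow g -[1+ k ]) (g ⁺)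

  zpow-pred : ∀ g a → g ⁻ ∷ zpow g a ≈ zpow g (pred a)
  zpow-pred g (+ zero)     = ≈-refl
  zpow-pred g (+ suc k)    = ≈-cancel [] (zpow g (+ k)) (g ⁻)
  zpow-pred g -[1+ k ]     = ≈-refl

  y-commutes-zpow-x : ∀ b a → (y , b) ∷ zpow x a ≈ zpow x a ++ (y , b) ∷ []
  y-commutes-zpow-x b (+ k)    = pass (y-commutes-x b false) k
  y-commutes-zpow-x b -[1+ k ] = pass (y-commutes-x b true) (suc k)

  t-negates-zpow : ∀ g → t ⁺ ∷ g ⁺ ∷ t ⁺ ∷ g ⁺ ∷ [] ≈ [] →
                   ∀ a → t ⁺ ∷ zpow g a ≈ zpow g (- a) ++ t ⁺ ∷ []
  t-negates-zpow g tgtg≈[] (+ zero)  = ≈-refl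
  t-negates-zpow g tgtg≈[] (+ suc k) = pass (proj₁ (t-inverts g tgtg≈[])) (suc k)
  t-negates-zpow g tgtg≈[] -[1+ k ]  = pass (proj₂ (t-inverts g tgtg≈[])) (suc k)

  t-step : ∀ a b s → t ⁺ ∷ nf (a , b , s) ≈ nf (- a , - b , not s)
  t-step a b s = begin
    (t ⁺ ∷ zpow x a) ++ zpow y b ++ tpow s
      ≈⟨ ++-congʳ (zpow y b ++ tpow s) (t-negates-zpow x txtx≈[] a) ⟩
    (zpow x (- a) ++ t ⁺ ∷ []) ++ zpow y b ++ tpow s
      ≡⟨ ++-assoc (zpow x (- a)) _ _ ⟩
    zpow x (- a) ++ (t ⁺ ∷ zpow y b) ++ tpow s
      ≈⟨ ++-congˡ (zpow x (- a)) (++-congʳ (tpow s) (t-negates-zpow y tyty≈[] b)) ⟩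
    zpow x (- a) ++ (zpow y (- b) ++ t ⁺ ∷ []) ++ tpow s
      ≡⟨ cong (zpow x (- a) ++_) (++-assoc (zpow y (- b)) _ _) ⟩
    zpow x (- a) ++ zpow y (- b) ++ t ⁺ ∷ tpow s
      ≈⟨ ++-congˡ (zpow x (- a)) (++-congˡ (zpow y (- b)) (t-tpow s)) ⟩
    nf (- a , - b , not s) ∎
    where
    txtx≈[] : t ⁺ ∷ x ⁺ ∷ t ⁺ ∷ x ⁺ ∷ [] ≈ []
    txtx≈[] = relator≈[] (there (there (there (here refl))))
    tyty≈[] : t ⁺ ∷ y ⁺ ∷ t ⁺ ∷ y ⁺ ∷ [] ≈ []
    tyty≈[] = relator≈[] (there (there (there (there (here refl)))))
    t-tpow : ∀ s → t ⁺ ∷ tpow s ≈ tpow (not s)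
    t-tpow false = ≈-refl
    t-tpow true  = t²≈[]

  y-step : ∀ c a b b′ s → (y , c) ∷ zpow y b ≈ zpow y b′ →
           (y , c) ∷ nf (a , b , s) ≈ nf (a , b′ , s)
  y-step c a b b′ s yb≈yb′ = begin
    ((y , c) ∷ zpow x a) ++ zpow y b ++ tpow s
      ≈⟨ ++-congʳ (zpow y b ++ tpow s) (y-commutes-zpow-x c a) ⟩
    (zpow x a ++ (y , c) ∷ []) ++ zpow y b ++ tpow s
      ≡⟨ ++-assoc (zpow x a) _ _ ⟩
    zpow x a ++ ((y , c) ∷ zpow y b) ++ tpow s
      ≈⟨ ++-congˡ (zpow x a) (++-congʳ (tpow s) yb≈yb′) ⟩
    nf (a , b′ , s) ∎

  step : ∀ l e → l ∷ nf e ≈ nf (⟦ l ⟧ · e)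
  step (x , false) (a , b , s) rewrite +-identityˡ b = ++-congʳ (zpow y b ++ tpow s) (zpow-suc x a)
  step (x , true)  (a , b , s) rewrite +-identityˡ b = ++-congʳ (zpow y b ++ tpow s) (zpow-pred x a)
  step (y , false) (a , b , s) rewrite +-identityˡ a = y-step false a b (sucℤ b) s (zpow-suc y b)
  step (y , true)  (a , b , s) rewrite +-identityˡ a = y-step true a b (pred b) s (zpow-pred y b)
  step (t , false) (a , b , s) rewrite +-identityˡ (- a) | +-identityˡ (- b) = t-step a b s
  step (t , true)  (a , b , s) rewrite +-identityˡ (- a) | +-identityˡ (- b) =
    ≈-trans (++-congʳ (nf (a , b , s)) t⁻≈t⁺) (t-step a b s)

  normal : ∀ w → w ≈ nf (eval w)
  normal []      = ≈-refl
  normal (l ∷ w) = ≈-trans (++-congˡ (l ∷ []) (normal w)) (step l (eval w))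

  relator~ε : ∀ {r} → r ∈ relators n m ℓ → eval r ~ ε
  relator~ε (here refl)                                = ~-reflexive refl
  relator~ε (there (here refl))                        =
    subst (_~ ε) (sym (eval-zpow-x (+ (n ℕ./ 2)))) (∈Λ⇒~ε N∈Λ)
  relator~ε (there (there (here refl)))                =
    subst (_~ ε) (sym (eval-y^m-x^-k m ((ℓ ℕ.+ m) ℕ./ 2))) (∈Λ⇒~ε KM∈Λ)
  relator~ε (there (there (there (here refl))))        = ~-reflexive refl
  relator~ε (there (there (there (there (here refl))))) = ~-reflexive refl
  relator~ε (there (there (there (there (there (here refl)))))) = ~-reflexive refl

  sound : ∀ {u v} → u ≈ v → eval u ~ eval v
  sound ≈-refl                 = ~-reflexive refl
  sound (≈-sym u≈v)            = ~-sym (sound u≈v)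
  sound (≈-trans u≈v v≈w)      = ~-trans (sound u≈v) (sound v≈w)
  sound (≈-cancel u v a)       = ~-reflexive (eval-cancel u v a)
  sound (≈-rel u v r r∈)       =
    subst₂ _~_ (sym (eval-++ u (r ++ v))) (sym (eval-++ u v)) (·-congˡ (eval u) rv~v)
    where
    rv~v : eval (r ++ v) ~ eval v
    rv~v = subst₂ _~_ (sym (eval-++ r v)) (·-identityˡ (eval v)) (·-congʳ (eval v) (relator~ε r∈))

  nf-· : ∀ e f → nf (e · f) ≈ nf e ++ nf f
  nf-· e f = begin
    nf (e · f)                      ≡⟨ cong nf (cong₂ _·_ (eval-nf e) (eval-nf f)) ⟨
    nf (eval (nf e) · eval (nf f))  ≡⟨ cong nf (eval-++ (nf e) (nf f)) ⟨
    nf (eval (nf e ++ nf f))        ≈⟨ normal (nf e ++ nf f) ⟨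
    nf e ++ nf f                    ∎

  nf-Λ : ∀ {p q} → (p , q) ∈Λ → nf (p , q , false) ≈ []
  nf-Λ = Λ-induction (λ (p , q) → nf (p , q , false) ≈ []) ≈-refl
    (relator⇒nf≈[] (eval-zpow-x (+ (n ℕ./ 2))) (there (here refl)))
    (relator⇒nf≈[] (eval-y^m-x^-k m ((ℓ ℕ.+ m) ℕ./ 2)) (there (there (here refl))))
    (λ {p} {q} {p′} {q′} pq≈[] p′q′≈[] →
       ≈-trans (nf-· (p , q , false) (p′ , q′ , false)) (++-cong pq≈[] p′q′≈[]))
    (λ {p} {q} → nf-neg {p} {q})
    where
    relator⇒nf≈[] : ∀ {r e} → eval r ≡ e → r ∈ relators n m ℓ → nf e ≈ []
    relator⇒nf≈[] {r} refl r∈ = ≈-trans (≈-sym (normal r)) (relator≈[] r∈)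
    nf-neg : ∀ {p q} → nf (p , q , false) ≈ [] → nf (- p , - q , false) ≈ []
    nf-neg {p} {q} pq≈[] = begin
      nf (- p , - q , false)
        ≡⟨ ++-identityʳ _ ⟨
      nf (- p , - q , false) ++ []
        ≈⟨ ++-congˡ (nf (- p , - q , false)) pq≈[] ⟨
      nf (- p , - q , false) ++ nf (p , q , false)
        ≈⟨ nf-· (- p , - q , false) (p , q , false) ⟨
      nf (- p + p , - q + q , false)
        ≡⟨ cong₂ (λ a b → nf (a , b , false)) (+-inverseˡ p) (+-inverseˡ q) ⟩
      [] ∎

  ~⇒nf≈ : ∀ {e f} → e ~ f → nf e ≈ nf f
  ~⇒nf≈ (~-intro {a} {b} {a′} {b′} {s} d∈Λ) = begin
    nf (a , b , s)
      ≡⟨ cong₂ (λ a b → nf (a , b , s)) (difference a a′) (difference b b′) ⟩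
    nf ((a - a′ , b - b′ , false) · (a′ , b′ , s))
      ≈⟨ nf-· (a - a′ , b - b′ , false) (a′ , b′ , s) ⟩
    nf (a - a′ , b - b′ , false) ++ nf (a′ , b′ , s)
      ≈⟨ ++-congʳ (nf (a′ , b′ , s)) (nf-Λ d∈Λ) ⟩
    nf (a′ , b′ , s) ∎
    where
    difference : ∀ a a′ → a ≡ a - a′ + a′
    difference a a′ = solve (a ∷ a′ ∷ [])

  complete : ∀ {u v} → eval u ~ eval v → u ≈ v
  complete {u} {v} eu~ev = begin
    u             ≈⟨ normal u ⟩
    nf (eval u)   ≈⟨ ~⇒nf≈ eu~ev ⟩
    nf (eval v)   ≈⟨ normal v ⟨
    v             ∎

  ≈-cancelˡ : ∀ u {v w} → u ++ v ≈ u ++ w → v ≈ w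
  ≈-cancelˡ u {v} {w} uv≈uw =
    complete (·-cancelˡ (eval u) (subst₂ _~_ (eval-++ u v) (eval-++ u w) (sound uv≈uw)))

  map-swap-respects-≈ : SwapClosed → ∀ {u v} → u ≈ v → map swap u ≈ map swap v
  map-swap-respects-≈ closed {u} {v} u≈v =
    complete (subst₂ _~_ (sym (eval-swap u)) (sym (eval-swap v)) (swapᴱ-~ closed (sound u≈v)))

  swap-isAutomorphism : SwapClosed → IsAutomorphism n m ℓ (map swap)
  swap-isAutomorphism closed = record
    { well-defined = λ u v → map-swap-respects-≈ closed
    ; homomorphism = λ u v → ≡⇒≈ (map-++ swap u v)
    ; injective    = λ u v → subst₂ _≈_ (map-swap-involutive u) (map-swap-involutive v)
                               ∘ map-swap-respects-≈ closed
    ; surjective   = λ w → map swap w , ≡⇒≈ (map-swap-involutive w)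
    }

  IsSwapAutomorphism : (Word → Word) → Set
  IsSwapAutomorphism φ = IsAutomorphism n m ℓ φ
    × φ (gen t) ≈ gen t
    × φ (t ⁺ ∷ x ⁺ ∷ []) ≈ t ⁺ ∷ y ⁺ ∷ []
    × φ (t ⁺ ∷ y ⁺ ∷ []) ≈ t ⁺ ∷ x ⁺ ∷ []

  module _ {φ : Word → Word} (φ-aut : IsAutomorphism n m ℓ φ) (φt≈t : φ (gen t) ≈ gen t)
           (φtx≈ty : φ (t ⁺ ∷ x ⁺ ∷ []) ≈ t ⁺ ∷ y ⁺ ∷ [])
           (φty≈tx : φ (t ⁺ ∷ y ⁺ ∷ []) ≈ t ⁺ ∷ x ⁺ ∷ []) where

    open IsAutomorphism φ-aut

    φ[]≈[] : φ [] ≈ []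
    φ[]≈[] = ≈-sym (≈-cancelˡ (φ []) (begin
      φ [] ++ []      ≡⟨ ++-identityʳ (φ []) ⟩
      φ []            ≈⟨ homomorphism [] [] ⟩
      φ [] ++ φ []    ∎))

    φ-strip-t : ∀ {a b} → φ (t ⁺ ∷ a ∷ []) ≈ t ⁺ ∷ b ∷ [] → φ (a ∷ []) ≈ b ∷ []
    φ-strip-t {a} {b} φta≈tb = ≈-cancelˡ (t ⁺ ∷ []) (begin
      t ⁺ ∷ φ (a ∷ [])              ≈⟨ ++-congʳ (φ (a ∷ [])) φt≈t ⟨
      φ (t ⁺ ∷ []) ++ φ (a ∷ [])    ≈⟨ homomorphism (t ⁺ ∷ []) (a ∷ []) ⟨
      φ (t ⁺ ∷ a ∷ [])              ≈⟨ φta≈tb ⟩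
      t ⁺ ∷ b ∷ []                  ∎)

    φ-inverse : ∀ {a b} → φ (a ∷ []) ≈ b ∷ [] → φ (inv-letter a ∷ []) ≈ inv-letter b ∷ []
    φ-inverse {a} {b} φa≈b = ≈-cancelˡ (b ∷ []) (begin
      b ∷ φ (inv-letter a ∷ [])              ≈⟨ ++-congʳ (φ (inv-letter a ∷ [])) φa≈b ⟨
      φ (a ∷ []) ++ φ (inv-letter a ∷ [])    ≈⟨ homomorphism (a ∷ []) (inv-letter a ∷ []) ⟨
      φ (a ∷ inv-letter a ∷ [])              ≈⟨ well-defined _ _ (inverse≈[] a) ⟩
      φ []                                   ≈⟨ φ[]≈[] ⟩
      []                                     ≈⟨ inverse≈[] b ⟨
      b ∷ inv-letter b ∷ []                  ∎)

    φ-letter : ∀ a → φ (a ∷ []) ≈ swap a ∷ []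
    φ-letter (x , false) = φ-strip-t φtx≈ty
    φ-letter (x , true)  = φ-inverse (φ-strip-t φtx≈ty)
    φ-letter (y , false) = φ-strip-t φty≈tx
    φ-letter (y , true)  = φ-inverse (φ-strip-t φty≈tx)
    φ-letter (t , false) = φt≈t
    φ-letter (t , true)  = φ-inverse φt≈t

    φ≈map-swap : ∀ w → φ w ≈ map swap w
    φ≈map-swap []      = φ[]≈[]
    φ≈map-swap (a ∷ w) = ≈-trans (homomorphism (a ∷ []) w) (++-cong (φ-letter a) (φ≈map-swap w))

    swapAutomorphism⇒swapClosed : SwapClosed
    swapAutomorphism⇒swapClosed {p} {q} pq∈Λ =
      ~ε⇒∈Λ (subst (_~ ε) (trans (eval-swap w) (cong swapᴱ (eval-nf (p , q , false))))
                          (sound swap-w≈[]))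
      where
      w : Word
      w = nf (p , q , false)
      swap-w≈[] : map swap w ≈ []
      swap-w≈[] = begin
        map swap w   ≈⟨ φ≈map-swap w ⟨
        φ w          ≈⟨ well-defined w [] (nf-Λ pq∈Λ) ⟩
        φ []         ≈⟨ φ[]≈[] ⟩
        []           ∎

  swapAutomorphism⇔swapClosed : Σ (Word → Word) IsSwapAutomorphism ⇔ SwapClosed
  swapAutomorphism⇔swapClosed = mk⇔
    (λ (_ , φ-aut , φt , φtx , φty) → swapAutomorphism⇒swapClosed φ-aut φt φtx φty) map-swap
    where
    map-swap : SwapClosed → Σ (Word → Word) IsSwapAutomorphism
    map-swap closed = map swap , swap-isAutomorphism closed , ≈-refl , ≈-refl , ≈-refl

module Arithmetic where

  import Data.Nat.Base as ℕ
  import Data.Nat.Properties as ℕ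
  open import Data.Integer.Base using (+_; -_; _+_; _-_; _*_; ∣_∣; 1ℤ)
  open import Data.Integer.Properties
    using (neg-involutive; neg-distribʳ-*; abs-*; pos-*; pos-+; *-comm; *-cancelˡ-≡)
  open import Data.Integer.Divisibility using (_∣_; *-cancelˡ-∣; *-monoʳ-∣)
  import Data.Integer.Divisibility.Signed as Signed
  open import Data.Integer.Tactic.RingSolver using (solve)
  import Data.Nat.Tactic.RingSolver as ℕ-Solver
  open import Data.Nat.Coprimality using (Coprime; coprime⇒gcd≡1)
  open import Data.Nat.Divisibility using (divides; ∣1⇒≡1) renaming (_∣_ to _∣ℕ_)
  open import Data.Nat.GCD using (gcd; gcd[m,n]∣m; gcd[m,n]∣n; c*gcd[m,n]≡gcd[cm,cn])
  open import Function.Base using (_∘_)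
  open Lattice using (SwapCriterion; swapCriterion)
  open ≡-Reasoning

  criterion-neg : ∀ {N K M} → SwapCriterion N K M → SwapCriterion N (- K) M
  criterion-neg {M = M} (swapCriterion N′ k′ c N≡M*N′ K≡M*k′ k′²-1≡c*N′) =
    swapCriterion N′ (- k′) c N≡M*N′ (trans (cong -_ K≡M*k′) (neg-distribʳ-* M k′))
      (trans (square-neg k′) k′²-1≡c*N′)
    where
    square-neg : ∀ a → - a * - a - 1ℤ ≡ a * a - 1ℤ
    square-neg a = solve (a ∷ [])

  criterion-neg⇔ : ∀ {N K M} → SwapCriterion N (- K) M ⇔ SwapCriterion N K M
  criterion-neg⇔ {N} {K} {M} =
    mk⇔ (subst (λ K → SwapCriterion N K M) (neg-involutive K) ∘ criterion-neg) criterion-neg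

  criterion⇒gcd∣ : ∀ {N k m} → SwapCriterion (+ N) (+ k) (+ m) →
                   gcd N k ≡ m × + (m ℕ.* N) ∣ + k * + k - + m * + m
  criterion⇒gcd∣ {N} {k} {m} (swapCriterion N′ k′ c N≡m*N′ k≡m*k′ k′²-1≡c*N′) =
    gcd≡m , mN∣k²-m²
    where
    coprime : Coprime ∣ N′ ∣ ∣ k′ ∣
    coprime {d} (d∣N′ , d∣k′) = ∣1⇒≡1 (Signed.∣⇒∣ᵤ (subst (+ d Signed.∣_) unit
      (Signed.∣m∣n⇒∣m-n (Signed.∣m⇒∣m*n k′ (Signed.∣ᵤ⇒∣ {i = k′} d∣k′))
                         (Signed.∣n⇒∣m*n c (Signed.∣ᵤ⇒∣ {i = N′} d∣N′)))))
      where
      unit : k′ * k′ - c * N′ ≡ 1ℤ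
      unit = begin
        k′ * k′ - c * N′              ≡⟨ cong (λ z → k′ * k′ - z) k′²-1≡c*N′ ⟨
        k′ * k′ - (k′ * k′ - 1ℤ)      ≡⟨ solve (k′ ∷ []) ⟩
        1ℤ                            ∎
    gcd≡m : gcd N k ≡ m
    gcd≡m = begin
      gcd N k
        ≡⟨ cong₂ gcd (trans (cong ∣_∣ N≡m*N′) (abs-* (+ m) N′))
                     (trans (cong ∣_∣ k≡m*k′) (abs-* (+ m) k′)) ⟩
      gcd (m ℕ.* ∣ N′ ∣) (m ℕ.* ∣ k′ ∣)
        ≡⟨ c*gcd[m,n]≡gcd[cm,cn] m ∣ N′ ∣ ∣ k′ ∣ ⟨
      m ℕ.* gcd ∣ N′ ∣ ∣ k′ ∣
        ≡⟨ cong (m ℕ.*_) (coprime⇒gcd≡1 coprime) ⟩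
      m ℕ.* 1
        ≡⟨ ℕ.*-identityʳ m ⟩
      m ∎
    mN∣k²-m² : + (m ℕ.* N) ∣ + k * + k - + m * + m
    mN∣k²-m² = Signed.∣⇒∣ᵤ (Signed.divides c (begin
      + k * + k - + m * + m             ≡⟨ cong (λ z → z * z - + m * + m) k≡m*k′ ⟩
      + m * k′ * (+ m * k′) - + m * + m ≡⟨ factor (+ m) k′ ⟩
      + m * + m * (k′ * k′ - 1ℤ)        ≡⟨ cong (+ m * + m *_) k′²-1≡c*N′ ⟩
      + m * + m * (c * N′)              ≡⟨ regroup (+ m) c N′ ⟩
      c * (+ m * (+ m * N′))            ≡⟨ cong (λ z → c * (+ m * z)) N≡m*N′ ⟨
      c * (+ m * + N)                   ≡⟨ cong (c *_) (pos-* m N) ⟨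
      c * + (m ℕ.* N)                   ∎))
      where
      factor : ∀ M k′ → M * k′ * (M * k′) - M * M ≡ M * M * (k′ * k′ - 1ℤ)
      factor M k′ = solve (M ∷ k′ ∷ [])
      regroup : ∀ M c N′ → M * M * (c * N′) ≡ c * (M * (M * N′))
      regroup M c N′ = solve (M ∷ c ∷ N′ ∷ [])

  gcd∣⇒criterion : ∀ {N k m} .{{_ : ℕ.NonZero m}} → gcd N k ≡ m →
                   + (m ℕ.* N) ∣ + k * + k - + m * + m → SwapCriterion (+ N) (+ k) (+ m)
  gcd∣⇒criterion {N} {k} {m} gcd≡m mN∣k²-m²
    with subst (_∣ℕ N) gcd≡m (gcd[m,n]∣m N k) | subst (_∣ℕ k) gcd≡m (gcd[m,n]∣n N k)
       | Signed.∣ᵤ⇒∣ mN∣k²-m²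
  ... | divides a N≡a*m | divides b k≡b*m | Signed.divides q k²-m²≡q*mN =
    swapCriterion (+ a) (+ b) q (pos-multiple N≡a*m) (pos-multiple k≡b*m)
      (*-cancelˡ-≡ (+ m) _ _ (*-cancelˡ-≡ (+ m) _ _ (begin
        + m * (+ m * (+ b * + b - 1ℤ))
          ≡⟨ expand (+ m) (+ b) ⟩
        + m * + b * (+ m * + b) - + m * + m
          ≡⟨ cong (λ z → z * z - + m * + m) (pos-multiple k≡b*m) ⟨
        + k * + k - + m * + m
          ≡⟨ k²-m²≡q*mN ⟩
        q * + (m ℕ.* N)
          ≡⟨ cong (q *_) (trans (pos-* m N) (cong (+ m *_) (pos-multiple N≡a*m))) ⟩
        q * (+ m * (+ m * + a))
          ≡⟨ regroup (+ m) q (+ a) ⟩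
        + m * (+ m * (q * + a)) ∎)))
    where
    pos-multiple : ∀ {u a} → u ≡ a ℕ.* m → + u ≡ + m * + a
    pos-multiple {a = a} refl = trans (pos-* a m) (*-comm (+ a) (+ m))
    expand : ∀ M b → M * (M * (b * b - 1ℤ)) ≡ M * b * (M * b) - M * M
    expand M b = solve (M ∷ b ∷ [])
    regroup : ∀ M q a → q * (M * (M * a)) ≡ M * (M * (q * a))
    regroup M q a = solve (M ∷ q ∷ a ∷ [])

  criterion⇔gcd∣ : ∀ {N k m} .{{_ : ℕ.NonZero m}} → SwapCriterion (+ N) (+ k) (+ m)
                   ⇔ (gcd N k ≡ m × + (m ℕ.* N) ∣ + k * + k - + m * + m)
  criterion⇔gcd∣ =
    mk⇔ criterion⇒gcd∣ (λ (gcd≡m , mN∣k²-m²) → gcd∣⇒criterion gcd≡m mN∣k²-m²)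

  halving : ∀ {n m ℓ N k} → n ≡ 2 ℕ.* N → ℓ ℕ.+ m ≡ 2 ℕ.* k →
            (gcd n (ℓ ℕ.+ m) ≡ 2 ℕ.* m
              × + (2 ℕ.* m ℕ.* n) ∣ (+ ℓ * + ℓ) + (+ 2 * + m * + ℓ) - (+ 3 * + m * + m))
            ⇔ (gcd N k ≡ m × + (m ℕ.* N) ∣ + k * + k - + m * + m)
  halving {n} {m} {ℓ} {N} {k} n≡2N ℓ+m≡2k = mk⇔
    (λ (gcd≡2m , 2mn∣E) →
       ℕ.*-cancelˡ-≡ _ m 2 (trans (sym gcd-double) gcd≡2m) ,
       *-cancelˡ-∣ (+ 4) {+ (m ℕ.* N)} {k²-m²} (subst₂ _∣_ 2mn≡4mN E≡4[k²-m²] 2mn∣E))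
    (λ (gcd≡m , mN∣k²-m²) →
       trans gcd-double (cong (2 ℕ.*_) gcd≡m) ,
       subst₂ _∣_ (sym 2mn≡4mN) (sym E≡4[k²-m²])
                  (*-monoʳ-∣ (+ 4) {+ (m ℕ.* N)} {k²-m²} mN∣k²-m²))
    where
    k²-m² : ℤ
    k²-m² = + k * + k - + m * + m
    gcd-double : gcd n (ℓ ℕ.+ m) ≡ 2 ℕ.* gcd N k
    gcd-double = trans (cong₂ gcd n≡2N ℓ+m≡2k) (sym (c*gcd[m,n]≡gcd[cm,cn] 2 N k))
    2mn≡4mN : + (2 ℕ.* m ℕ.* n) ≡ + 4 * + (m ℕ.* N)
    2mn≡4mN = begin
      + (2 ℕ.* m ℕ.* n)          ≡⟨ cong (λ n → + (2 ℕ.* m ℕ.* n)) n≡2N ⟩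
      + (2 ℕ.* m ℕ.* (2 ℕ.* N))  ≡⟨ cong +_ (regroup m N) ⟩
      + (4 ℕ.* (m ℕ.* N))        ≡⟨ pos-* 4 (m ℕ.* N) ⟩
      + 4 * + (m ℕ.* N)          ∎
      where
      open ℕ-Solver using (solve-∀)
      regroup : ∀ m N → 2 ℕ.* m ℕ.* (2 ℕ.* N) ≡ 4 ℕ.* (m ℕ.* N)
      regroup = solve-∀
    ℓ≡2k-m : + ℓ ≡ + 2 * + k - + m
    ℓ≡2k-m = begin
      + ℓ                ≡⟨ add-sub (+ ℓ) (+ m) ⟩
      + ℓ + + m - + m    ≡⟨ cong (_- + m) (pos-+ ℓ m) ⟨
      + (ℓ ℕ.+ m) - + m  ≡⟨ cong (λ z → + z - + m) ℓ+m≡2k ⟩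
      + (2 ℕ.* k) - + m  ≡⟨ cong (_- + m) (pos-* 2 k) ⟩
      + 2 * + k - + m    ∎
      where
      add-sub : ∀ L M → L ≡ L + M - M
      add-sub L M = solve (L ∷ M ∷ [])
    E≡4[k²-m²] : (+ ℓ * + ℓ) + (+ 2 * + m * + ℓ) - (+ 3 * + m * + m) ≡ + 4 * k²-m²
    E≡4[k²-m²] = trans (cong (λ L → (L * L) + (+ 2 * + m * L) - (+ 3 * + m * + m)) ℓ≡2k-m)
                       (difference-of-squares (+ k) (+ m))
      where
      difference-of-squares : ∀ K M → (+ 2 * K - M) * (+ 2 * K - M) + (+ 2 * M * (+ 2 * K - M))
                                      - (+ 3 * M * M) ≡ + 4 * (K * K - M * M)
      difference-of-squares K M = solve (K ∷ M ∷ [])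

open import Data.Nat using (_≤_; _<_; _*_; _+_)
open import Data.Nat.Divisibility using (_∣_)
open import Data.Nat.GCD using (gcd)
open import Data.Integer using (+_; _-_) renaming (_*_ to _*ℤ_; _+_ to _+ℤ_)
open import Data.Integer.Divisibility using () renaming (_∣_ to _∣ℤ_)

lemma4p1 : (n m ℓ : ℕ) → 1 ≤ m → 4 ≤ n → 2 ∣ n → ℓ < n → 2 ∣ (ℓ + m) →
    (Σ (Word → Word) (λ φ → IsAutomorphism n m ℓ φ
        × φ (gen t) ≈[ n , m , ℓ ] gen t
        × φ ((t , false) ∷ (x , false) ∷ []) ≈[ n , m , ℓ ] ((t , false) ∷ (y , false) ∷ [])
        × φ ((t , false) ∷ (y , false) ∷ []) ≈[ n , m , ℓ ] ((t , false) ∷ (x , false) ∷ [])))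
    ⇔ ((gcd n (ℓ + m) ≡ 2 * m)
        × ((+ (2 * m * n)) ∣ℤ ((+ ℓ *ℤ + ℓ) +ℤ (+ 2 *ℤ + m *ℤ + ℓ) - (+ 3 *ℤ + m *ℤ + m))))
lemma4p1 n zero      ℓ ()
lemma4p1 n m@(suc _) ℓ _ _ 2∣n _ 2∣ℓ+m = begin
  Σ (Word → Word) IsSwapAutomorphism                     ≈⟨ swapAutomorphism⇔swapClosed ⟩
  SwapClosed                                             ≈⟨ swapClosed⇔criterion (λ ()) ⟩
  SwapCriterion (+ N) (- + k) (+ m)                      ≈⟨ criterion-neg⇔ ⟩
  SwapCriterion (+ N) (+ k) (+ m)                        ≈⟨ criterion⇔gcd∣ ⟩
  (gcd N k ≡ m × + (m * N) ∣ℤ + k *ℤ + k - + m *ℤ + m)   ≈⟨ halving n≡2N ℓ+m≡2k ⟨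
  _                                                      ∎
  where
  open import Data.Integer using (-_)
  open import Data.Nat using (_/_)
  open import Data.Nat.DivMod using (m*[n/m]≡n)
  open import Function.Properties.Equivalence using (⇔-setoid)
  open import Level using (0ℓ)
  open import Relation.Binary.Reasoning.Setoid (⇔-setoid 0ℓ)
  open Presentation n m ℓ
    using (IsSwapAutomorphism; swapAutomorphism⇔swapClosed; SwapClosed; swapClosed⇔criterion)
  open Lattice using (SwapCriterion)
  open Arithmetic using (criterion-neg⇔; criterion⇔gcd∣; halving)
  N k : ℕ
  N = n / 2
  k = (ℓ + m) / 2
  n≡2N : n ≡ 2 * N
  n≡2N = sym (m*[n/m]≡n 2∣n)
  ℓ+m≡2k : ℓ + m ≡ 2 * k
  ℓ+m≡2k = sym (m*[n/m]≡n 2∣ℓ+m)
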